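{- Let $w$ be a finite or (right-)infinite rich word. If $u$ and $v$ are factors of $w$ with the same longest palindromic prefix $p$ and the same longest palindromic suffix $q$, then $u = v$.
   Context: For a finite word $w = x_1x_2\cdots x_m$ (letters $x_i$), $|w| = m$ is its length and $\tilde w = x_m\cdots x_2x_1$ its reversal; $w$ is a palindrome if $w = \tilde w$, and the empty word $\varepsilon$ is considered a palindrome. A finite word $z$ is a factor of a finite or infinite word $w$ if $w = uzv$ for some words $u,v$; it is a prefix if $u=\varepsilon$ and a suffix if $v = \varepsilon$. A finite word $w$ is rich if it has exactly $|w|+1$ distinct palindromic factors (including $\varepsilon$); an infinite word is rich if all of its finite factors are rich. -}

module Defs where

open import Data.Nat using (ℕ; zero; suc; _≤_)
open import Data.List using (List; []; _∷_; _++_; length; reverse)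
open import Data.List.Membership.Propositional using (_∈_)
open import Data.List.Relation.Unary.Unique.Propositional using (Unique)
open import Data.Product using (Σ; ∃; ∃-syntax; _×_; _,_)
open import Relation.Binary.PropositionalEquality using (_≡_)

Palindrome : {A : Set} → List A → Set
Palindrome w = reverse w ≡ w

FactorOf : {A : Set} → List A → List A → Set
FactorOf {A} z w = ∃[ x ] ∃[ y ] (w ≡ x ++ z ++ y)

IsPrefix : {A : Set} → List A → List A → Set
IsPrefix {A} p w = ∃[ y ] (w ≡ p ++ y)

IsSuffix : {A : Set} → List A → List A → Set
IsSuffix {A} s w = ∃[ x ] (w ≡ x ++ s)

PalFactor : {A : Set} → List A → List A → Set
PalFactor w z = Palindrome z × FactorOf z w

-- w has exactly |w|+1 distinct palindromic factors (ε included):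
-- there is a duplicate-free list of length |w|+1 whose elements are
-- exactly the palindromic factors of w.
RichFin : {A : Set} → List A → Set
RichFin {A} w = Σ (List (List A)) λ L →
  Unique L × length L ≡ suc (length w) ×
  (∀ z → z ∈ L → PalFactor w z) × (∀ z → PalFactor w z → z ∈ L)

IsLPP : {A : Set} → List A → List A → Set
IsLPP p u = IsPrefix p u × Palindrome p ×
  (∀ p' → IsPrefix p' u → Palindrome p' → length p' ≤ length p)

IsLPS : {A : Set} → List A → List A → Set
IsLPS q u = IsSuffix q u × Palindrome q ×
  (∀ q' → IsSuffix q' u → Palindrome q' → length q' ≤ length q)

data Word (A : Set) : Set where
  fin : List A → Word A
  inf : (ℕ → A) → Word A

slice : {A : Set} → (ℕ → A) → ℕ → ℕ → List A
slice x i zero = []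
slice x i (suc n) = x i ∷ slice x (suc i) n

Factor : {A : Set} → List A → Word A → Set
Factor z (fin w) = FactorOf z w
Factor z (inf x) = ∃[ i ] (z ≡ slice x i (length z))

Rich : {A : Set} → Word A → Set
Rich (fin w) = RichFin w
Rich (inf x) = ∀ z → Factor z (inf x) → RichFin z

-- In a rich word the longest palindromic prefix occurs only once: deleting the first letter of a
-- rich word aw loses at most one palindromic factor, necessarily a palindromic prefix of aw, and
-- counting forces the longest one to be lost (and w to stay rich). By reversal the same holds for
-- the longest palindromic suffix.
--
-- For a finite rich word W argue by induction on |W|; an infinite word is reduced to a finite
-- prefix containing both factors. If neither occurrence is at the front of W, both lie in the rich
-- word W minus its first letter; dually at the back. Otherwise each of u, v is a prefix or a suffix
-- of W. Two prefixes coincide because the common longest palindromic suffix q occurs only once in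
-- the longer one, and dually for two suffixes; if u = W then v starts at the only occurrence of p.
-- If u is a proper prefix and v a proper suffix, then u is shorter than the longest palindromic
-- prefix s of W and reverse v shorter than that of reverse W. Either s = W is a palindrome, which is
-- handled directly, or reflecting through these two palindromes places both u and v in reverse W
-- away from its first letter.

module Submission where

open import Defs
open import Data.Empty using (⊥-elim)
open import Data.List using (List; []; _∷_; _++_; length; reverse)
open import Data.List.Properties
  using (∷-injective; ∷-injectiveʳ; ++-assoc; ++-identityʳ; ++-conicalˡ; ++-conicalʳ;
         length-++-≤ˡ; length-reverse; reverse-++; reverse-involutive; reverse-injective)
open import Data.List.Membership.Propositional using (_∈_; _∉_)
open import Data.List.Relation.Binary.Subset.Propositional using (_⊆_)
open import Data.List.Relation.Binary.Subset.Propositional.Properties using (∷⁺ʳ)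
import Data.List.Relation.Unary.All as All
open import Data.List.Relation.Unary.All.Properties using (¬Any⇒All¬)
open import Data.List.Relation.Unary.AllPairs using ([]; _∷_)
open import Data.List.Relation.Unary.Any using (here; there)
open import Data.List.Relation.Unary.Unique.Propositional using (Unique)
open import Data.List.Relation.Unary.Unique.Propositional.Properties using (Unique[x∷xs]⇒x∉xs)
open import Data.Nat using (ℕ; zero; suc; _≤_; _<_; _+_; z≤n; s≤s; z<s; _≤?_)
open import Data.Nat.Properties
open import Data.Product using (∃-syntax; _×_; _,_; proj₁; proj₂)
open import Data.Sum using (_⊎_; inj₁; inj₂)
open import Function using (_∘_)
open import Relation.Nullary using (¬_; yes; no)
open import Relation.Binary.Definitions using (tri<; tri≈; tri>)
open import Relation.Binary.PropositionalEquality

module _ {A : Set} where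

  ++-split : ∀ (a b c d : List A) → a ++ b ≡ c ++ d → length a ≤ length c →
             ∃[ t ] c ≡ a ++ t × b ≡ t ++ d
  ++-split []      b c       d eq _ = c , refl , eq
  ++-split (x ∷ a) b (y ∷ c) d eq (s≤s a≤c)
    with refl , eq′ ← ∷-injective eq
    with t , refl , b≡ ← ++-split a b c d eq′ a≤c
    = t , refl , b≡

  ++-cancel-length : ∀ (a b c d : List A) → a ++ b ≡ c ++ d → length a ≡ length c → a ≡ c
  ++-cancel-length []      b []      d _  _ = refl
  ++-cancel-length (x ∷ a) b (y ∷ c) d eq len with refl , eq′ ← ∷-injective eq
    = cong (x ∷_) (++-cancel-length a b c d eq′ (suc-injective len))

  ⊆-∷-swap : ∀ {B : Set} {x y : B} {xs ys} → xs ⊆ y ∷ ys → x ∷ xs ⊆ y ∷ x ∷ ys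
  ⊆-∷-swap _ (here refl) = there (here refl)
  ⊆-∷-swap xs⊆ (there x∈) with xs⊆ x∈
  ... | here eq   = here eq
  ... | there x∈′ = there (there x∈′)

  reverse-++₃ : ∀ (x u y : List A) → reverse (x ++ u ++ y) ≡ reverse y ++ reverse u ++ reverse x
  reverse-++₃ x u y = begin
    reverse (x ++ u ++ y)                  ≡⟨ reverse-++ x (u ++ y) ⟩
    reverse (u ++ y) ++ reverse x          ≡⟨ cong (_++ reverse x) (reverse-++ u y) ⟩
    (reverse y ++ reverse u) ++ reverse x  ≡⟨ ++-assoc (reverse y) (reverse u) (reverse x) ⟩
    reverse y ++ reverse u ++ reverse x    ∎
    where open ≡-Reasoning

  prefix-refl : ∀ (w : List A) → IsPrefix w w
  prefix-refl w = [] , sym (++-identityʳ w)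

  prefix-trans : ∀ {a b c : List A} → IsPrefix a b → IsPrefix b c → IsPrefix a c
  prefix-trans {a} (t , refl) (t′ , refl) = t ++ t′ , ++-assoc a t t′

  prefix-length : ∀ {p w : List A} → IsPrefix p w → length p ≤ length w
  prefix-length {p} (_ , refl) = length-++-≤ˡ p

  prefix-≤ : ∀ {s t w : List A} → IsPrefix s w → IsPrefix t w →
             length s ≤ length t → IsPrefix s t
  prefix-≤ {s} {t} (ys , refl) (yt , eq) s≤t
    with r , t≡ , _ ← ++-split s ys t yt eq s≤t = r , t≡

  prefix-≡ : ∀ {s t w : List A} → IsPrefix s w → IsPrefix t w →
             length s ≡ length t → s ≡ t
  prefix-≡ {s} {t} (ys , refl) (yt , eq) = ++-cancel-length s ys t yt eq

  proper-prefix : ∀ {a s : List A} → IsPrefix a s → length a < length s →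
                  ∃[ t ] s ≡ a ++ t × 0 < length t
  proper-prefix {a} ([]    , refl) a<s = ⊥-elim (<-irrefl (cong length (sym (++-identityʳ a))) a<s)
  proper-prefix     (c ∷ t , refl) _   = c ∷ t , refl , z<s

  0<length-reverse : ∀ (t : List A) → 0 < length t → 0 < length (reverse t)
  0<length-reverse t = subst (0 <_) (sym (length-reverse t))

  prefix-reverse : ∀ {p w : List A} → IsPrefix p w → IsSuffix (reverse p) (reverse w)
  prefix-reverse {p} (y , refl) = reverse y , reverse-++ p y

  suffix-reverse : ∀ {s w : List A} → IsSuffix s w → IsPrefix (reverse s) (reverse w)
  suffix-reverse {s} (x , refl) = reverse x , reverse-++ x s

  palindrome-swap : ∀ {s a b : List A} → Palindrome s → s ≡ a ++ b →
                    s ≡ reverse b ++ reverse a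
  palindrome-swap {s} {a} {b} ps eq = trans (sym ps) (trans (cong reverse eq) (reverse-++ a b))

  lpp-reverse : ∀ {p u : List A} → IsLPP p u → IsLPS p (reverse u)
  lpp-reverse {p} {u} (p⊑u , pp , max) =
    subst (λ s → IsSuffix s (reverse u)) pp (prefix-reverse p⊑u) , pp ,
    λ s s⊒ ps → max s (subst₂ IsPrefix ps (reverse-involutive u) (suffix-reverse s⊒)) ps

  lps-reverse : ∀ {q u : List A} → IsLPS q u → IsLPP q (reverse u)
  lps-reverse {q} {u} (q⊒u , pq , max) =
    subst (λ s → IsPrefix s (reverse u)) pq (suffix-reverse q⊒u) , pq ,
    λ s s⊑ ps → max s (subst₂ IsSuffix ps (reverse-involutive u) (prefix-reverse s⊑)) ps

  palindrome-lpp-self : ∀ {u : List A} → Palindrome u → IsLPP u u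
  palindrome-lpp-self {u} pu = prefix-refl u , pu , λ _ s⊑u _ → prefix-length s⊑u

  lpp-unique : ∀ {p p′ w : List A} → IsLPP p w → IsLPP p′ w → p ≡ p′
  lpp-unique (p⊑ , pp , max) (p′⊑ , pp′ , max′) =
    prefix-≡ p⊑ p′⊑ (≤-antisym (max′ _ p⊑ pp) (max _ p′⊑ pp′))

  factor-reverse : ∀ {z w : List A} → FactorOf z w → FactorOf (reverse z) (reverse w)
  factor-reverse {z} (x , y , refl) = reverse y , reverse x , reverse-++₃ x z y

  palFactor-reverse : ∀ {w z : List A} → PalFactor w z → PalFactor (reverse w) z
  palFactor-reverse {w} (pz , z∈w) =
    pz , subst (λ t → FactorOf t (reverse w)) pz (factor-reverse z∈w)

  palFactor-unreverse : ∀ {w z : List A} → PalFactor (reverse w) z → PalFactor w z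
  palFactor-unreverse {w} {z} =
    subst (λ t → PalFactor t z) (reverse-involutive w) ∘ palFactor-reverse

  rich-reverse : ∀ {w : List A} → RichFin w → RichFin (reverse w)
  rich-reverse {w} (M , uM , lenM , sound , complete) =
    M , uM , trans lenM (cong suc (sym (length-reverse w))) ,
    (λ z → palFactor-reverse ∘ sound z) , (λ z → complete z ∘ palFactor-unreverse)

  -- Counting palindromic factors

  palFactor-∷ : ∀ {a : A} {w z} → PalFactor w z → PalFactor (a ∷ w) z
  palFactor-∷ {a} (pz , x , y , eq) = pz , a ∷ x , y , cong (a ∷_) eq

  palFactor-∷-cases : ∀ {a : A} {w z} → PalFactor (a ∷ w) z →
                      PalFactor w z ⊎ (Palindrome z × IsPrefix z (a ∷ w))
  palFactor-∷-cases (pz , []    , y , eq) = inj₂ (pz , y , eq)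
  palFactor-∷-cases (pz , _ ∷ x , y , eq) = inj₁ (pz , x , y , ∷-injectiveʳ eq)

  factor-[] : ∀ {z : List A} → FactorOf z [] → z ≡ []
  factor-[] {z} (x , y , eq) = ++-conicalˡ z y (++-conicalʳ x (z ++ y) (sym eq))

  -- A palindromic prefix t of aw ends with every shorter palindromic prefix s, so s occurs in w.
  shorter-palindromic-prefix-in-tail : ∀ {a : A} {w s t} → Palindrome s → Palindrome t →
    IsPrefix s (a ∷ w) → IsPrefix t (a ∷ w) → length s < length t → FactorOf s w
  shorter-palindromic-prefix-in-tail {s = s} {t} ps pt s⊑ t⊑@(y , aw≡) s<t
    with r , t≡s++r ← prefix-≤ s⊑ t⊑ (<⇒≤ s<t)
    with reverse r | trans (palindrome-swap {a = s} pt t≡s++r) (cong (reverse r ++_) ps)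
  ... | []     | t≡s = ⊥-elim (<-irrefl (cong length (sym t≡s)) s<t)
  ... | c ∷ r′ | t≡  =
    r′ , y , trans (∷-injectiveʳ (trans aw≡ (cong (_++ y) t≡))) (++-assoc r′ s y)

  unique-∷ : ∀ {z : List A} {M} → z ∉ M → Unique M → Unique (z ∷ M)
  unique-∷ {M = M} z∉M uM = ¬Any⇒All¬ M z∉M ∷ uM

  -- Sorting the palindromic factors M of aw into those known to occur in w (old) and at most one
  -- palindromic prefix of aw that is not shown to occur in w.
  data NewPrefix (a : A) (w : List A) (M old : List (List A)) : Set where
    none : length M ≡ length old → M ⊆ old → NewPrefix a w M old
    one  : ∀ {s} → s ∈ M → s ∉ old → Palindrome s → IsPrefix s (a ∷ w) →
           length M ≡ suc (length old) → M ⊆ s ∷ old → NewPrefix a w M old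

  record TailSplit (a : A) (w : List A) (M : List (List A)) : Set where
    constructor tailSplit
    field
      old        : List (List A)
      old-unique : Unique old
      old-pal    : ∀ z → z ∈ old → PalFactor w z
      old⊆M      : old ⊆ M
      new        : NewPrefix a w M old

  tailSplit-old : ∀ {a : A} {w z M} → z ∉ M → PalFactor w z →
                  TailSplit a w M → TailSplit a w (z ∷ M)
  tailSplit-old {a} {w} {z} {M} z∉M pz (tailSplit old uold pal old⊆M new) =
    tailSplit (z ∷ old) (unique-∷ (z∉M ∘ old⊆M) uold)
      (λ { _ (here refl) → pz ; y (there y∈) → pal y y∈ }) (∷⁺ʳ z old⊆M) (extend new)
    where
    extend : NewPrefix a w M old → NewPrefix a w (z ∷ M) (z ∷ old)
    extend (none len M⊆) = none (cong suc len) (∷⁺ʳ z M⊆)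
    extend (one s∈M s∉old ps s⊑ len M⊆) =
      one (there s∈M) (λ { (here refl) → z∉M s∈M ; (there s∈) → s∉old s∈ }) ps s⊑
        (cong suc len) (⊆-∷-swap M⊆)

  tailSplit-prefix : ∀ {a : A} {w z M} → z ∉ M → Palindrome z → IsPrefix z (a ∷ w) →
                     TailSplit a w M → TailSplit a w (z ∷ M)
  tailSplit-prefix {z = z} z∉M pz z⊑ (tailSplit old uold pal old⊆M (none len M⊆)) =
    tailSplit old uold pal (there ∘ old⊆M)
      (one (here refl) (z∉M ∘ old⊆M) pz z⊑ (cong suc len) (∷⁺ʳ z M⊆))
  tailSplit-prefix {z = z} z∉M pz z⊑
                   sp@(tailSplit old uold pal old⊆M (one {s} s∈M s∉old ps s⊑ len M⊆))
    with <-cmp (length z) (length s)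
  ... | tri< |z|<|s| _ _ =
    tailSplit-old z∉M (pz , shorter-palindromic-prefix-in-tail pz ps z⊑ s⊑ |z|<|s|) sp
  ... | tri≈ _ |z|≡|s| _ =
    ⊥-elim (z∉M (subst (_∈ _) (sym (prefix-≡ z⊑ s⊑ |z|≡|s|)) s∈M))
  ... | tri> _ _ |s|<|z| =
    tailSplit (s ∷ old) (unique-∷ s∉old uold)
      (λ { _ (here refl) → ps , shorter-palindromic-prefix-in-tail ps pz s⊑ z⊑ |s|<|z|
         ; y (there y∈)  → pal y y∈ })
      (λ { (here refl) → there s∈M ; (there y∈) → there (old⊆M y∈) })
      (one (here refl) (λ { (here refl) → z∉M s∈M ; (there z∈) → z∉M (old⊆M z∈) })
        pz z⊑ (cong suc len) (∷⁺ʳ z M⊆))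

  tailSplit-of : ∀ {a : A} {w} M → Unique M → (∀ z → z ∈ M → PalFactor (a ∷ w) z) →
                 TailSplit a w M
  tailSplit-of []      _               _   = tailSplit [] [] (λ _ ()) (λ ()) (none refl (λ ()))
  tailSplit-of (z ∷ M) uzM@(_ ∷ uM) pal
    with palFactor-∷-cases (pal z (here refl)) | tailSplit-of M uM (λ y → pal y ∘ there)
  ... | inj₁ pz         | split-M = tailSplit-old    (Unique[x∷xs]⇒x∉xs uzM) pz     split-M
  ... | inj₂ (pz , z⊑) | split-M = tailSplit-prefix (Unique[x∷xs]⇒x∉xs uzM) pz z⊑ split-M

  palFactors-bound : ∀ (w : List A) M → Unique M → (∀ z → z ∈ M → PalFactor w z) →
                     length M ≤ suc (length w)
  palFactors-bound []      []           _                    _   = z≤n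
  palFactors-bound []      (_ ∷ [])     _                    _   = s≤s z≤n
  palFactors-bound []      (z ∷ z′ ∷ _) ((z≢z′ All.∷ _) ∷ _) pal = ⊥-elim (z≢z′ (trans
    (factor-[] (proj₂ (pal z (here refl))))
    (sym (factor-[] (proj₂ (pal z′ (there (here refl))))))))
  palFactors-bound (a ∷ w) M uM pal with tailSplit-of M uM pal
  ... | tailSplit old uold opal _ (none len _) =
    ≤-trans (≤-reflexive len) (m≤n⇒m≤1+n (palFactors-bound w old uold opal))
  ... | tailSplit old uold opal _ (one _ _ _ _ len _) =
    ≤-trans (≤-reflexive len) (s≤s (palFactors-bound w old uold opal))

  rich-∷ : ∀ {a : A} {w} → RichFin (a ∷ w) →
           RichFin w × ∃[ s ] IsLPP s (a ∷ w) × ¬ FactorOf s w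
  rich-∷ {a} {w} (M , uM , lenM , sound , complete) with tailSplit-of M uM sound
  ... | tailSplit old uold opal _ (none len _) = ⊥-elim (1+n≰n
    (subst (_≤ suc (length w)) (trans (sym len) lenM) (palFactors-bound w old uold opal)))
  ... | tailSplit old uold opal _ (one {s} _ s∉old ps s⊑ len M⊆) =
    (old , uold , len-old , opal , complete-old) , s , (s⊑ , ps , maximal) , s∉w
    where
    len-old : length old ≡ suc (length w)
    len-old = suc-injective (trans (sym len) lenM)

    s∉w : ¬ FactorOf s w
    s∉w s∈w = 1+n≰n (subst (λ n → suc n ≤ suc (length w)) len-old
      (palFactors-bound w (s ∷ old) (unique-∷ s∉old uold)
        (λ { _ (here refl) → ps , s∈w ; z (there z∈) → opal z z∈ })))

    maximal : ∀ t → IsPrefix t (a ∷ w) → Palindrome t → length t ≤ length s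
    maximal t t⊑ pt = ≮⇒≥ (s∉w ∘ shorter-palindromic-prefix-in-tail ps pt s⊑ t⊑)

    complete-old : ∀ z → PalFactor w z → z ∈ old
    complete-old z pz with M⊆ (complete z (palFactor-∷ pz))
    ... | here refl = ⊥-elim (s∉w (proj₂ pz))
    ... | there z∈  = z∈

  rich-tail : ∀ {a : A} {w} → RichFin (a ∷ w) → RichFin w
  rich-tail = proj₁ ∘ rich-∷

  rich-drop : ∀ (x : List A) {w} → RichFin (x ++ w) → RichFin w
  rich-drop []      R = R
  rich-drop (_ ∷ x) R = rich-drop x (rich-tail R)

  rich-unreverse : ∀ {w : List A} → RichFin (reverse w) → RichFin w
  rich-unreverse {w} = subst RichFin (reverse-involutive w) ∘ rich-reverse

  rich-factor : ∀ {W f : List A} → RichFin W → FactorOf f W → RichFin f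
  rich-factor {f = f} R (x , y , refl) = rich-unreverse (rich-drop (reverse y)
    (subst RichFin (reverse-++ f y) (rich-reverse (rich-drop x R))))

  rich-prefix : ∀ {W v : List A} → RichFin W → IsPrefix v W → RichFin v
  rich-prefix R (y , eq) = rich-factor R ([] , y , eq)

  -- Longest palindromic prefixes and suffixes in rich words

  lpp-exists : ∀ {W : List A} → RichFin W → ∃[ s ] IsLPP s W
  lpp-exists {[]}    _ = [] , prefix-refl [] , refl , λ _ s⊑ _ → prefix-length s⊑
  lpp-exists {_ ∷ _} R with _ , s , ls , _ ← rich-∷ R = s , ls

  lpp-unioccurrent : ∀ {W p : List A} x y → RichFin W → IsLPP p W →
                     W ≡ x ++ p ++ y → x ≡ []
  lpp-unioccurrent          []      _ _ _  _  = refl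
  lpp-unioccurrent {[]}     (_ ∷ _) _ _ _  ()
  lpp-unioccurrent {_ ∷ _}  (_ ∷ x) y R lp eq
    with _ , s , ls , s∉w ← rich-∷ R
    with refl ← lpp-unique lp ls
    = ⊥-elim (s∉w (x , y , ∷-injectiveʳ eq))

  lps-unioccurrent : ∀ {W q : List A} x y → RichFin W → IsLPS q W →
                     W ≡ x ++ q ++ y → y ≡ []
  lps-unioccurrent {W} {q} x y R lq@(_ , pq , _) eq =
    reverse-injective (lpp-unioccurrent (reverse y) (reverse x) (rich-reverse R) (lps-reverse lq)
      (trans (cong reverse eq)
        (trans (reverse-++₃ x q y) (cong (λ t → reverse y ++ t ++ reverse x) pq))))

  lpp-factor-prefix : ∀ {W s v : List A} x y → RichFin W → IsLPP s W →
                      W ≡ x ++ v ++ y → IsLPP s v → x ≡ []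
  lpp-factor-prefix {s = s} x y R ls eq ((r , v≡) , _) = lpp-unioccurrent x (r ++ y) R ls
    (trans eq (cong (x ++_) (trans (cong (_++ y) v≡) (++-assoc s r y))))

  lpp-of-long-prefix : ∀ {s u W : List A} → IsLPP s W → IsPrefix u W →
                       length s ≤ length u → IsLPP s u
  lpp-of-long-prefix (s⊑W , ps , max) u⊑W s≤u =
    prefix-≤ s⊑W u⊑W s≤u , ps , λ t t⊑u pt → max t (prefix-trans t⊑u u⊑W) pt

  same-lpp-as-long-prefix⇒prefix : ∀ {W s u v p : List A} x → RichFin W → IsLPP s W →
    IsPrefix u W → length s ≤ length u → W ≡ x ++ v → IsLPP p u → IsLPP p v → x ≡ []
  same-lpp-as-long-prefix⇒prefix {v = v} x R ls u⊑ s≤u W≡ lpu lpv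
    with refl ← lpp-unique (lpp-of-long-prefix ls u⊑ s≤u) lpu
    = lpp-factor-prefix x [] R ls (trans W≡ (cong (x ++_) (sym (++-identityʳ v)))) lpv

  lpp-lps-whole : ∀ {r v : List A} → RichFin v → IsLPP r v → IsLPS r v → v ≡ r
  lpp-lps-whole {r} R lp ((x , v≡) , _)
    with refl ← lpp-unioccurrent x [] R lp (trans v≡ (cong (x ++_) (sym (++-identityʳ r))))
    = v≡

  record SameEnds (p q u v : List A) : Set where
    constructor sameEnds
    field
      lppˡ : IsLPP p u
      lppʳ : IsLPP p v
      lpsˡ : IsLPS q u
      lpsʳ : IsLPS q v

  sameEnds-sym : ∀ {p q u v : List A} → SameEnds p q u v → SameEnds p q v u
  sameEnds-sym (sameEnds lpu lpv lsu lsv) = sameEnds lpv lpu lsv lsu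

  sameEnds-reverse : ∀ {p q u v : List A} → SameEnds p q u v →
                     SameEnds q p (reverse u) (reverse v)
  sameEnds-reverse (sameEnds lpu lpv lsu lsv) =
    sameEnds (lps-reverse lsu) (lps-reverse lsv) (lpp-reverse lpu) (lpp-reverse lpv)

  Determined : List A → Set
  Determined W = ∀ {p q u v} → FactorOf u W → FactorOf v W → SameEnds p q u v → u ≡ v

  DeterminedUpTo : ℕ → Set
  DeterminedUpTo n = ∀ W → length W ≤ n → RichFin W → Determined W

  prefix-same-lps : ∀ {q u v : List A} → RichFin v → IsPrefix u v →
                    IsLPS q u → IsLPS q v → u ≡ v
  prefix-same-lps {q} {u} R (t , v≡) ((u₀ , u≡) , _) lsv
    with refl ← lps-unioccurrent u₀ t R lsv
                  (trans v≡ (trans (cong (_++ t) u≡) (++-assoc u₀ q t)))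
    = sym (trans v≡ (++-identityʳ u))

  prefixes-same-lps : ∀ {W q u v : List A} → RichFin W → IsPrefix u W → IsPrefix v W →
                      IsLPS q u → IsLPS q v → u ≡ v
  prefixes-same-lps {u = u} {v} R u⊑ v⊑ lsu lsv with ≤-total (length u) (length v)
  ... | inj₁ u≤v = prefix-same-lps (rich-prefix R v⊑) (prefix-≤ u⊑ v⊑ u≤v) lsu lsv
  ... | inj₂ v≤u = sym (prefix-same-lps (rich-prefix R u⊑) (prefix-≤ v⊑ u⊑ v≤u) lsv lsu)

  factor-of-self : ∀ {p q u v : List A} → RichFin u → FactorOf v u → SameEnds p q u v → u ≡ v
  factor-of-self R (x , y , u≡) (sameEnds lpu lpv lsu lsv)
    with refl ← lpp-factor-prefix x y R lpu u≡ lpv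
    = sym (prefix-same-lps R (y , u≡) lsv lsu)

  -- u = u₀ q is a prefix of reverse v, whose LPP is q; unioccurrence gives u = q, a palindrome.
  prefix-of-reverse : ∀ {p q u v : List A} → RichFin v → IsPrefix u (reverse v) →
                      SameEnds p q u v → u ≡ v
  prefix-of-reverse {q = q} R (t , v̄≡) (sameEnds lpu lpv ((u₀ , u≡) , pq , _) lsv)
    with refl ← lpp-unioccurrent u₀ t (rich-reverse R) (lps-reverse lsv)
                  (trans v̄≡ (trans (cong (_++ t) u≡) (++-assoc u₀ q t)))
    with refl ← u≡
    with refl ← lpp-unique lpu (palindrome-lpp-self pq)
    = sym (lpp-lps-whole R lpv lsv)

  palindrome-prefix-suffix : ∀ {W p q u v : List A} → RichFin W → Palindrome W →
                             IsPrefix u W → IsSuffix v W → SameEnds p q u v → u ≡ v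
  palindrome-prefix-suffix {u = u} {v} R pW u⊑ v⊒ ends
    with ≤-total (length u) (length (reverse v))
       | subst (IsPrefix (reverse v)) pW (suffix-reverse v⊒)
  ... | inj₁ u≤v̄ | v̄⊑ =
    prefix-of-reverse (rich-unreverse (rich-prefix R v̄⊑)) (prefix-≤ u⊑ v̄⊑ u≤v̄) ends
  ... | inj₂ v̄≤u | v̄⊑ = sym (reverse-injective (prefix-of-reverse
    (rich-reverse (rich-prefix R u⊑))
    (subst (IsPrefix (reverse v)) (sym (reverse-involutive u)) (prefix-≤ v̄⊑ u⊑ v̄≤u))
    (sameEnds-reverse (sameEnds-sym ends))))

  non-initial-occurrences : ∀ {n W p q u v} x₁ y₁ x₂ y₂ → DeterminedUpTo n →
    length W ≤ suc n → RichFin W → 0 < length x₁ → 0 < length x₂ →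
    W ≡ x₁ ++ u ++ y₁ → W ≡ x₂ ++ v ++ y₂ → SameEnds p q u v → u ≡ v
  non-initial-occurrences {W = []}    (_ ∷ _)  _  _        _  _ _         _ _ _ () _
  non-initial-occurrences {W = _ ∷ w} (_ ∷ x₁) y₁ (_ ∷ x₂) y₂ IH (s≤s len) R _ _ e₁ e₂ =
    IH w len (rich-tail R) (x₁ , y₁ , ∷-injectiveʳ e₁) (x₂ , y₂ , ∷-injectiveʳ e₂)

  reverse-palindromic-prefix : ∀ {W s ys u t : List A} → Palindrome s →
    W ≡ s ++ ys → s ≡ u ++ t → reverse W ≡ reverse ys ++ u ++ t
  reverse-palindromic-prefix {W} {s} {ys} {u} {t} ps W≡ s≡ = begin
    reverse W               ≡⟨ cong reverse W≡ ⟩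
    reverse (s ++ ys)       ≡⟨ reverse-++ s ys ⟩
    reverse ys ++ reverse s ≡⟨ cong (reverse ys ++_) (trans ps s≡) ⟩
    reverse ys ++ u ++ t    ∎
    where open ≡-Reasoning

  palindromic-prefix-swap : ∀ {W s ys v t : List A} → Palindrome s →
    W ≡ s ++ ys → s ≡ reverse v ++ t → W ≡ reverse t ++ v ++ ys
  palindromic-prefix-swap {W} {s} {ys} {v} {t} ps W≡ s≡ = begin
    W                                        ≡⟨ W≡ ⟩
    s ++ ys                                  ≡⟨ cong (_++ ys) (palindrome-swap {a = reverse v} ps s≡) ⟩
    (reverse t ++ reverse (reverse v)) ++ ys ≡⟨ cong (λ z → (reverse t ++ z) ++ ys)
                                                     (reverse-involutive v) ⟩
    (reverse t ++ v) ++ ys                   ≡⟨ ++-assoc (reverse t) v ys ⟩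
    reverse t ++ v ++ ys                     ∎
    where open ≡-Reasoning

  short-prefix-and-suffix : ∀ {n W s s′ p q u v x y} → DeterminedUpTo n → length W ≤ suc n →
    RichFin W → IsLPP s W → IsLPP s′ (reverse W) → length u < length s → length s < length W →
    length (reverse v) < length s′ → W ≡ u ++ y → W ≡ x ++ v → SameEnds p q u v → u ≡ v
  short-prefix-and-suffix {n} {W} {s} {s′} {u = u} {v} {x} {y} IH len R
                          (s⊑W , ps , _) (s′⊑W̄@(ys′ , W̄≡) , ps′ , _) u<s s<W v̄<s′
                          W≡u++y W≡x++v ends
    with t₁ , s≡ ← prefix-≤ {u} {s} (y , W≡u++y) s⊑W (<⇒≤ u<s)
    with ys , W≡s++ys , 0<ys ← proper-prefix s⊑W s<W
    with t₂ , s′≡ , 0<t₂ ← proper-prefix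
           (prefix-≤ {reverse v} {s′} (suffix-reverse (x , W≡x++v)) s′⊑W̄ (<⇒≤ v̄<s′)) v̄<s′
    = non-initial-occurrences (reverse ys) t₁ (reverse t₂) ys′ IH
        (subst (_≤ suc n) (sym (length-reverse W)) len) (rich-reverse R)
        (0<length-reverse ys 0<ys) (0<length-reverse t₂ 0<t₂)
        (reverse-palindromic-prefix {u = u} ps W≡s++ys s≡)
        (palindromic-prefix-swap {v = v} ps′ W̄≡ s′≡) ends

  -- If u or reverse v were at least as long as the LPP of W or of reverse W, unioccurrence of
  -- that LPP would force v to be a prefix (or u a suffix) of W.
  proper-prefix-and-suffix : ∀ {n W p q u v b c x y} → DeterminedUpTo n → length W ≤ suc n →
    RichFin W → W ≡ u ++ c ∷ y → W ≡ (b ∷ x) ++ v → SameEnds p q u v → u ≡ v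
  proper-prefix-and-suffix {W = W} {u = u} {v} {b} {c} {x} {y} IH len R W≡u++cy W≡bx++v
                           ends@(sameEnds lpu lpv lsu lsv)
    with s , ls ← lpp-exists R
    with s′ , ls′ ← lpp-exists (rich-reverse R)
    with length s ≤? length u | length s′ ≤? length (reverse v)
       | m≤n⇒m<n∨m≡n (prefix-length (proj₁ ls))
  ... | yes s≤u | _ | _
    with () ← same-lpp-as-long-prefix⇒prefix (b ∷ x) R ls (c ∷ y , W≡u++cy) s≤u W≡bx++v lpu lpv
  ... | no _ | yes s′≤v̄ | _
    with () ← trans (sym (length-reverse (c ∷ y))) (cong length
                (same-lpp-as-long-prefix⇒prefix (reverse (c ∷ y)) (rich-reverse R) ls′
                  (suffix-reverse (b ∷ x , W≡bx++v)) s′≤v̄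
                  (trans (cong reverse W≡u++cy) (reverse-++ u (c ∷ y)))
                  (lps-reverse lsv) (lps-reverse lsu)))
  ... | no _ | no _ | inj₂ |s|≡|W| = palindrome-prefix-suffix R
    (subst Palindrome (prefix-≡ (proj₁ ls) (prefix-refl W) |s|≡|W|) (proj₁ (proj₂ ls)))
    (c ∷ y , W≡u++cy) (b ∷ x , W≡bx++v) ends
  ... | no s≰u | no s′≰v̄ | inj₁ s<W =
    short-prefix-and-suffix IH len R ls ls′ (≰⇒> s≰u) s<W (≰⇒> s′≰v̄) W≡u++cy W≡bx++v ends

  suffix-occurrence : ∀ {W : List A} x v → W ≡ x ++ v ++ [] → W ≡ x ++ v
  suffix-occurrence x v W≡ = trans W≡ (cong (x ++_) (++-identityʳ v))

  determined-≤ : ∀ n → DeterminedUpTo n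
  determined-≤ zero    []      _   _ fu fv _ = trans (factor-[] fu) (sym (factor-[] fv))
  determined-≤ (suc n) W len R (b₁ ∷ x₁ , y₁ , e₁) (b₂ ∷ x₂ , y₂ , e₂) ends =
    non-initial-occurrences (b₁ ∷ x₁) y₁ (b₂ ∷ x₂) y₂ (determined-≤ n) len R z<s z<s e₁ e₂ ends
  determined-≤ (suc n) W len R {u = u} {v} (x₁ , c₁ ∷ y₁ , e₁) (x₂ , c₂ ∷ y₂ , e₂) ends =
    reverse-injective (non-initial-occurrences
      (reverse (c₁ ∷ y₁)) (reverse x₁) (reverse (c₂ ∷ y₂)) (reverse x₂) (determined-≤ n)
      (subst (_≤ suc n) (sym (length-reverse W)) len) (rich-reverse R)
      (0<length-reverse (c₁ ∷ y₁) z<s) (0<length-reverse (c₂ ∷ y₂) z<s)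
      (trans (cong reverse e₁) (reverse-++₃ x₁ u (c₁ ∷ y₁)))
      (trans (cong reverse e₂) (reverse-++₃ x₂ v (c₂ ∷ y₂)))
      (sameEnds-reverse ends))
  determined-≤ (suc n) W len R ([] , y₁ , e₁) ([] , y₂ , e₂) (sameEnds _ _ lsu lsv) =
    prefixes-same-lps R (y₁ , e₁) (y₂ , e₂) lsu lsv
  determined-≤ (suc n) W len R {u = u} {v} (x₁ , [] , e₁) (x₂ , [] , e₂) (sameEnds lpu lpv _ _) =
    reverse-injective (prefixes-same-lps (rich-reverse R)
      (suffix-reverse (x₁ , suffix-occurrence x₁ u e₁))
      (suffix-reverse (x₂ , suffix-occurrence x₂ v e₂))
      (lpp-reverse lpu) (lpp-reverse lpv))
  determined-≤ (suc n) W len R {u = u} ([] , [] , e₁) fv ends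
    with refl ← suffix-occurrence [] u e₁ = factor-of-self R fv ends
  determined-≤ (suc n) W len R {v = v} fu ([] , [] , e₂) ends
    with refl ← suffix-occurrence [] v e₂ = sym (factor-of-self R fu (sameEnds-sym ends))
  determined-≤ (suc n) W len R {v = v} ([] , _ ∷ _ , e₁) (b ∷ x₂ , [] , e₂) ends =
    proper-prefix-and-suffix (determined-≤ n) len R e₁ (suffix-occurrence (b ∷ x₂) v e₂) ends
  determined-≤ (suc n) W len R {u = u} (b ∷ x₁ , [] , e₁) ([] , _ ∷ _ , e₂) ends =
    sym (proper-prefix-and-suffix (determined-≤ n) len R e₂ (suffix-occurrence (b ∷ x₁) u e₁)
           (sameEnds-sym ends))

  rich-determined : ∀ {W : List A} → RichFin W → Determined W
  rich-determined {W} = determined-≤ (length W) W ≤-refl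

  -- Infinite words

  slice-++ : ∀ (x : ℕ → A) i m n → slice x i (m + n) ≡ slice x i m ++ slice x (i + m) n
  slice-++ x i zero    n = cong (λ k → slice x k n) (sym (+-identityʳ i))
  slice-++ x i (suc m) n = cong (x i ∷_) (trans (slice-++ x (suc i) m n)
    (cong (λ k → slice x (suc i) m ++ slice x k n) (sym (+-suc i m))))

  length-slice : ∀ (x : ℕ → A) i n → length (slice x i n) ≡ n
  length-slice x i zero    = refl
  length-slice x i (suc n) = cong suc (length-slice x (suc i) n)

  slice-factor : ∀ (x : ℕ → A) {i m N} → i + m ≤ N → FactorOf (slice x i m) (slice x 0 N)
  slice-factor x {i} {m} i+m≤N with r , refl ← m≤n⇒∃[o]m+o≡n i+m≤N =
    slice x 0 i , slice x (i + m) r , (begin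
      slice x 0 (i + m + r)                           ≡⟨ cong (slice x 0) (+-assoc i m r) ⟩
      slice x 0 (i + (m + r))                         ≡⟨ slice-++ x 0 i (m + r) ⟩
      slice x 0 i ++ slice x i (m + r)                ≡⟨ cong (slice x 0 i ++_)
                                                              (slice-++ x i m r) ⟩
      slice x 0 i ++ slice x i m ++ slice x (i + m) r ∎)
    where open ≡-Reasoning

  common-finite-prefix : ∀ (x : ℕ → A) {u v} → Factor u (inf x) → Factor v (inf x) →
    ∃[ N ] Factor (slice x 0 N) (inf x) × FactorOf u (slice x 0 N) × FactorOf v (slice x 0 N)
  common-finite-prefix x {u} {v} (i , u≡) (j , v≡) =
    N , (0 , cong (slice x 0) (sym (length-slice x 0 N))) ,
    subst (λ z → FactorOf z (slice x 0 N)) (sym u≡) (slice-factor x (m≤m+n _ (j + length v))) ,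
    subst (λ z → FactorOf z (slice x 0 N)) (sym v≡) (slice-factor x (m≤n+m _ (i + length u)))
    where
    N = i + length u + (j + length v)

lemma3p2 : {A : Set} (w : Word A) → Rich w →
    (u v p q : List A) → Factor u w → Factor v w →
    IsLPP p u → IsLPP p v → IsLPS q u → IsLPS q v → u ≡ v
lemma3p2 (fin w) R u v p q fu fv lpu lpv lsu lsv =
  rich-determined R fu fv (sameEnds lpu lpv lsu lsv)
lemma3p2 (inf x) R u v p q fu fv lpu lpv lsu lsv
  with N , prefix∈x , fu′ , fv′ ← common-finite-prefix x fu fv
  = rich-determined (R (slice x 0 N) prefix∈x) fu′ fv′ (sameEnds lpu lpv lsu lsv)
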